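{- There exists a simple $5$-$(16,7,10)$ design.
   Context: A $t$-$(v,k,\lambda)$ design consists of a $v$-element set $P$ of points together with a collection $B$ of $k$-element subsets of $P$ (called blocks) such that every $t$-element subset of $P$ is contained in exactly $\lambda$ blocks. The design is simple if $B$ is a set, i.e. contains no repeated blocks. -}

module Defs where

open import Data.Nat using (ℕ)
open import Data.Fin.Subset using (Subset; _⊆_; ∣_∣)
open import Data.Fin.Subset.Properties using (_⊆?_)
open import Data.List using (List; length; filter)
open import Data.List.Relation.Unary.All using (All)
open import Data.List.Relation.Unary.Unique.Propositional using (Unique)
open import Relation.Binary.PropositionalEquality using (_≡_)

-- Points are Fin v; a block is a subset of Fin v (Subset v = Vec Bool v).
-- A collection of blocks is a list of subsets (multiset: repetitions allowed).

blocksContaining : {v : ℕ} → Subset v → List (Subset v) → ℕ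
blocksContaining T B = length (filter (T ⊆?_) B)

record IsDesign (t v k lam : ℕ) (B : List (Subset v)) : Set where
  field
    blockSize : All (λ b → ∣ b ∣ ≡ k) B
    balanced  : (T : Subset v) → ∣ T ∣ ≡ t → blocksContaining T B ≡ lam

record IsSimpleDesign (t v k lam : ℕ) (B : List (Subset v)) : Set where
  field
    design : IsDesign t v k lam B
    simple : Unique B

module Submission where

-- The design is an explicit list of 2080 blocks, so the proof is a certified computation.
-- A t-set of points either avoids point 0, and then lies in the same blocks once point 0
-- is deleted from every block, or contains point 0, and then its remaining (t-1)-set is
-- counted by the derived design at point 0; recursing over the points turns balance into
-- a boolean check.  Simplicity follows from the blocks being listed in strictly increasing
-- lexicographic order.

open import Defs
open import Data.Bool using (Bool; true; false; T; _∧_)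
open import Data.Bool.Properties using (T-∧)
import Data.Bool.Properties as Bool
open import Data.Fin.Subset using (Subset; outside; inside; ∣_∣)
open import Data.Fin.Subset.Properties using (_⊆?_)
open import Data.List using (List; []; _∷_; map; length; filter)
open import Data.List.Relation.Unary.All using (all?)
import Data.List.Relation.Unary.AllPairs as AllPairs
open import Data.List.Relation.Unary.Linked using (Linked; linked?)
open import Data.List.Relation.Unary.Linked.Properties using (Linked⇒AllPairs)
open import Data.List.Relation.Unary.Unique.Propositional using (Unique)
open import Data.Nat using (ℕ; zero; suc; _≡ᵇ_; _%_; _/_)
import Data.Nat as ℕ
open import Data.Nat.Properties using (≡ᵇ⇒≡)
open import Data.Product using (∃; _,_; proj₁; proj₂)
open import Data.Vec using ([]; _∷_; head; tail)
import Data.Vec.Relation.Binary.Lex.Strict as Lex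
open import Function using (_∘_)
open import Function.Bundles using (Equivalence)
open import Level using (Level)
open import Relation.Binary.Bundles using (StrictPartialOrder)
open import Relation.Binary.PropositionalEquality using (_≡_; refl; cong; trans)
open import Relation.Nullary using (does)
open import Relation.Nullary.Decidable using (T?; toWitness)

Balanced : {v : ℕ} → ℕ → ℕ → List (Subset v) → Set
Balanced t lam B = (X : Subset _) → ∣ X ∣ ≡ t → blocksContaining X B ≡ lam

derived : {v : ℕ} → List (Subset (suc v)) → List (Subset v)
derived = map tail ∘ filter (T? ∘ head)

blocksContaining-[] : (B : List (Subset 0)) → blocksContaining [] B ≡ length B
blocksContaining-[] []       = refl
blocksContaining-[] ([] ∷ B) = cong suc (blocksContaining-[] B)

blocksContaining-outside : {v : ℕ} (X : Subset v) (B : List (Subset (suc v))) →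
                           blocksContaining (outside ∷ X) B ≡ blocksContaining X (map tail B)
blocksContaining-outside X []            = refl
blocksContaining-outside X ((_ ∷ b) ∷ B) with does (X ⊆? b)
... | true  = cong suc (blocksContaining-outside X B)
... | false = blocksContaining-outside X B

blocksContaining-inside : {v : ℕ} (X : Subset v) (B : List (Subset (suc v))) →
                          blocksContaining (inside ∷ X) B ≡ blocksContaining X (derived B)
blocksContaining-inside X []                  = refl
blocksContaining-inside X ((outside ∷ b) ∷ B) = blocksContaining-inside X B
blocksContaining-inside X ((inside ∷ b) ∷ B) with does (X ⊆? b)
... | true  = cong suc (blocksContaining-inside X B)
... | false = blocksContaining-inside X B

balancedᵇ : (t lam : ℕ) {v : ℕ} → List (Subset v) → Bool
balancedᵇ zero    lam {zero}  B = length B ≡ᵇ lam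
balancedᵇ (suc t) lam {zero}  B = true
balancedᵇ zero    lam {suc v} B = balancedᵇ zero lam (map tail B)
balancedᵇ (suc t) lam {suc v} B = balancedᵇ t lam (derived B) ∧ balancedᵇ (suc t) lam (map tail B)

balancedᵇ-sound : (t lam : ℕ) {v : ℕ} (B : List (Subset v)) → T (balancedᵇ t lam B) → Balanced t lam B
balancedᵇ-sound zero    lam {zero}  B ok []            refl = trans (blocksContaining-[] B) (≡ᵇ⇒≡ (length B) lam ok)
balancedᵇ-sound zero    lam {suc v} B ok (outside ∷ X) ∣X∣≡t =
  trans (blocksContaining-outside X B) (balancedᵇ-sound zero lam (map tail B) ok X ∣X∣≡t)
balancedᵇ-sound (suc t) lam {suc v} B ok (outside ∷ X) ∣X∣≡t =
  trans (blocksContaining-outside X B) (balancedᵇ-sound (suc t) lam (map tail B) (proj₂ (Equivalence.to T-∧ ok)) X ∣X∣≡t)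
balancedᵇ-sound (suc t) lam {suc v} B ok (inside ∷ X)  refl =
  trans (blocksContaining-inside X B) (balancedᵇ-sound t lam (derived B) (proj₁ (Equivalence.to T-∧ ok)) X refl)

module _ {a ℓ₁ ℓ₂ : Level} (S : StrictPartialOrder a ℓ₁ ℓ₂) where
  open StrictPartialOrder S using (Carrier; _<_; irrefl; module Eq) renaming (trans to <-trans)

  strictlyAscending⇒Unique : {xs : List Carrier} → Linked _<_ xs → Unique xs
  strictlyAscending⇒Unique = AllPairs.map (λ { x<y refl → irrefl Eq.refl x<y }) ∘ Linked⇒AllPairs <-trans

lexStrictPartialOrder : (v : ℕ) → StrictPartialOrder _ _ _
lexStrictPartialOrder = Lex.<-strictPartialOrder Bool.<-strictPartialOrder

fromBits : (v : ℕ) → ℕ → Subset v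
fromBits zero    m = []
fromBits (suc v) m = (m % 2 ≡ᵇ 1) ∷ fromBits v (m / 2)

-- Bit i of a code (least significant first) says whether point i lies in the block.
codes : List ℕ
codes =
  48768 ∷ 62848 ∷ 60800 ∷ 56192 ∷ 28544 ∷ 16256 ∷ 64064 ∷ 56896 ∷ 32064 ∷ 59200 ∷ 40768 ∷ 16192 ∷
  48320 ∷ 31936 ∷ 56000 ∷ 58816 ∷ 46016 ∷ 29632 ∷ 43968 ∷ 22464 ∷ 12224 ∷ 8128 ∷ 32288 ∷ 62752 ∷
  60192 ∷ 46880 ∷ 53024 ∷ 40736 ∷ 63648 ∷ 62112 ∷ 59040 ∷ 52896 ∷ 40608 ∷ 47520 ∷ 54688 ∷ 30112 ∷
  27552 ∷ 15264 ∷ 62560 ∷ 56416 ∷ 62048 ∷ 44640 ∷ 59744 ∷ 31072 ∷ 45920 ∷ 22368 ∷ 36704 ∷ 8032 ∷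
  30944 ∷ 44256 ∷ 23264 ∷ 38624 ∷ 14048 ∷ 53728 ∷ 39392 ∷ 26080 ∷ 19936 ∷ 50144 ∷ 35808 ∷ 10208 ∷
  64016 ∷ 48400 ∷ 31504 ∷ 55056 ∷ 53008 ∷ 28432 ∷ 63632 ∷ 60560 ∷ 54928 ∷ 46736 ∷ 61840 ∷ 23952 ∷
  29584 ∷ 43920 ∷ 20368 ∷ 12176 ∷ 62544 ∷ 59984 ∷ 47696 ∷ 30288 ∷ 61776 ∷ 55632 ∷ 52560 ∷ 27984 ∷
  38736 ∷ 14160 ∷ 46288 ∷ 23760 ∷ 58064 ∷ 39632 ∷ 26320 ∷ 36560 ∷ 27088 ∷ 14800 ∷ 42448 ∷ 50128 ∷
  7120 ∷ 18384 ∷ 60464 ∷ 56368 ∷ 31280 ∷ 44592 ∷ 46384 ∷ 23856 ∷ 58160 ∷ 54064 ∷ 36656 ∷ 20272 ∷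
  29872 ∷ 15536 ∷ 53936 ∷ 23216 ∷ 26288 ∷ 11952 ∷ 51632 ∷ 27056 ∷ 38320 ∷ 36272 ∷ 41904 ∷ 6064 ∷
  47216 ∷ 15472 ∷ 27248 ∷ 50800 ∷ 38512 ∷ 20080 ∷ 57712 ∷ 39280 ∷ 42352 ∷ 7536 ∷ 21360 ∷ 11120 ∷
  51440 ∷ 43248 ∷ 50416 ∷ 21744 ∷ 41712 ∷ 13040 ∷ 19184 ∷ 6896 ∷ 20976 ∷ 12784 ∷ 34288 ∷ 9712 ∷
  62984 ∷ 60936 ∷ 48392 ∷ 62216 ∷ 31496 ∷ 24328 ∷ 56456 ∷ 60040 ∷ 30344 ∷ 55688 ∷ 52616 ∷ 40328 ∷
  58248 ∷ 42888 ∷ 14216 ∷ 48200 ∷ 31304 ∷ 24136 ∷ 55624 ∷ 47432 ∷ 58696 ∷ 44360 ∷ 52040 ∷ 51016 ∷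
  26440 ∷ 61640 ∷ 59592 ∷ 54472 ∷ 15048 ∷ 42696 ∷ 38600 ∷ 20168 ∷ 11976 ∷ 29128 ∷ 21960 ∷ 36296 ∷
  37832 ∷ 19400 ∷ 31784 ∷ 55848 ∷ 54824 ∷ 31016 ∷ 27944 ∷ 15656 ∷ 43816 ∷ 39720 ∷ 50984 ∷ 61608 ∷
  46248 ∷ 44200 ∷ 15016 ∷ 22184 ∷ 20136 ∷ 11944 ∷ 43432 ∷ 26024 ∷ 7592 ∷ 37800 ∷ 21416 ∷ 19368 ∷
  34728 ∷ 59496 ∷ 46184 ∷ 23656 ∷ 43624 ∷ 39528 ∷ 26216 ∷ 13928 ∷ 53608 ∷ 11624 ∷ 25448 ∷ 13160 ∷
  34664 ∷ 18280 ∷ 51432 ∷ 26856 ∷ 50408 ∷ 7400 ∷ 49896 ∷ 25320 ∷ 41448 ∷ 12776 ∷ 6632 ∷ 3560 ∷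
  56344 ∷ 31768 ∷ 44568 ∷ 40472 ∷ 59672 ∷ 54552 ∷ 29976 ∷ 43800 ∷ 39704 ∷ 14104 ∷ 47256 ∷ 58520 ∷
  45720 ∷ 27288 ∷ 23192 ∷ 50840 ∷ 7832 ∷ 45464 ∷ 22936 ∷ 36248 ∷ 50072 ∷ 10136 ∷ 6040 ∷ 52312 ∷
  27736 ∷ 53848 ∷ 29272 ∷ 51800 ∷ 42584 ∷ 29016 ∷ 14680 ∷ 38232 ∷ 41816 ∷ 7000 ∷ 3928 ∷ 25816 ∷
  13528 ∷ 36056 ∷ 7384 ∷ 21208 ∷ 10968 ∷ 37336 ∷ 35288 ∷ 18904 ∷ 17880 ∷ 9176 ∷ 47160 ∷ 58424 ∷
  45624 ∷ 51768 ∷ 26168 ∷ 13880 ∷ 53560 ∷ 22840 ∷ 42296 ∷ 11576 ∷ 25400 ∷ 13112 ∷ 5944 ∷ 28856 ∷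
  39096 ∷ 14520 ∷ 19640 ∷ 35512 ∷ 34488 ∷ 49592 ∷ 25016 ∷ 5560 ∷ 3000 ∷ 57464 ∷ 38008 ∷ 21624 ∷
  11384 ∷ 21112 ∷ 6776 ∷ 3704 ∷ 18808 ∷ 10616 ∷ 17784 ∷ 33656 ∷ 41208 ∷ 37112 ∷ 1784 ∷ 1016 ∷
  32260 ∷ 63748 ∷ 56580 ∷ 62212 ∷ 46852 ∷ 44804 ∷ 31876 ∷ 55940 ∷ 59012 ∷ 30340 ∷ 24196 ∷ 46468 ∷
  44420 ∷ 52100 ∷ 39812 ∷ 51076 ∷ 60484 ∷ 58948 ∷ 52804 ∷ 28228 ∷ 47428 ∷ 54596 ∷ 54084 ∷ 23364 ∷
  15172 ∷ 61636 ∷ 59588 ∷ 54468 ∷ 45764 ∷ 43716 ∷ 20164 ∷ 27076 ∷ 22980 ∷ 13764 ∷ 36292 ∷ 7620 ∷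
  25540 ∷ 34756 ∷ 60452 ∷ 48164 ∷ 59940 ∷ 47652 ∷ 54820 ∷ 27940 ∷ 23844 ∷ 15140 ∷ 26404 ∷ 22308 ∷
  52388 ∷ 40100 ∷ 45732 ∷ 27300 ∷ 13988 ∷ 57764 ∷ 45476 ∷ 22948 ∷ 50596 ∷ 21412 ∷ 10148 ∷ 4004 ∷
  55396 ∷ 29796 ∷ 29284 ∷ 42596 ∷ 20068 ∷ 29028 ∷ 51556 ∷ 42340 ∷ 38244 ∷ 11620 ∷ 50020 ∷ 11108 ∷
  7012 ∷ 39140 ∷ 14564 ∷ 19684 ∷ 11492 ∷ 25316 ∷ 35556 ∷ 34532 ∷ 18148 ∷ 41444 ∷ 5604 ∷ 5092 ∷
  48148 ∷ 46612 ∷ 40468 ∷ 15892 ∷ 59668 ∷ 58644 ∷ 51988 ∷ 26388 ∷ 22292 ∷ 30868 ∷ 54420 ∷ 44180 ∷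
  58004 ∷ 7828 ∷ 39316 ∷ 14740 ∷ 26004 ∷ 21908 ∷ 37780 ∷ 13204 ∷ 35732 ∷ 19348 ∷ 61524 ∷ 30804 ∷
  23636 ∷ 39508 ∷ 22100 ∷ 11860 ∷ 43348 ∷ 13652 ∷ 36180 ∷ 7508 ∷ 41812 ∷ 25428 ∷ 19284 ∷ 34644 ∷
  51412 ∷ 50388 ∷ 38100 ∷ 11476 ∷ 21204 ∷ 13012 ∷ 9940 ∷ 3796 ∷ 49620 ∷ 37332 ∷ 55348 ∷ 29748 ∷
  57908 ∷ 23092 ∷ 42548 ∷ 7732 ∷ 28980 ∷ 39220 ∷ 14644 ∷ 50484 ∷ 37684 ∷ 13108 ∷ 11060 ∷ 53428 ∷
  43188 ∷ 26804 ∷ 7348 ∷ 35508 ∷ 34484 ∷ 5812 ∷ 41396 ∷ 9652 ∷ 3508 ∷ 17332 ∷ 45172 ∷ 25716 ∷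
  13428 ∷ 35956 ∷ 49780 ∷ 37492 ∷ 10868 ∷ 18804 ∷ 17780 ∷ 1908 ∷ 24820 ∷ 20724 ∷ 2548 ∷ 1012 ∷
  61964 ∷ 47628 ∷ 52748 ∷ 61708 ∷ 29964 ∷ 52492 ∷ 27404 ∷ 38668 ∷ 12044 ∷ 7948 ∷ 55436 ∷ 29836 ∷
  27788 ∷ 15500 ∷ 29324 ∷ 43660 ∷ 36492 ∷ 27020 ∷ 14732 ∷ 38284 ∷ 41868 ∷ 7052 ∷ 18316 ∷ 47180 ∷
  58444 ∷ 40012 ∷ 15436 ∷ 27212 ∷ 38476 ∷ 13900 ∷ 45388 ∷ 21836 ∷ 19788 ∷ 21324 ∷ 35660 ∷ 10060 ∷
  22732 ∷ 42188 ∷ 49868 ∷ 37580 ∷ 5836 ∷ 49612 ∷ 25036 ∷ 10700 ∷ 3020 ∷ 1996 ∷ 30764 ∷ 58412 ∷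
  54316 ∷ 53804 ∷ 36396 ∷ 11820 ∷ 7724 ∷ 51500 ∷ 39212 ∷ 42284 ∷ 13612 ∷ 41772 ∷ 19244 ∷ 57516 ∷
  43180 ∷ 38060 ∷ 21164 ∷ 6828 ∷ 20908 ∷ 17836 ∷ 3500 ∷ 33708 ∷ 9132 ∷ 22636 ∷ 35948 ∷ 41580 ∷
  12908 ∷ 19052 ∷ 5740 ∷ 49516 ∷ 24940 ∷ 35180 ∷ 5484 ∷ 37100 ∷ 12524 ∷ 17644 ∷ 9452 ∷ 2796 ∷
  59420 ∷ 55324 ∷ 46108 ∷ 23068 ∷ 14876 ∷ 50716 ∷ 26140 ∷ 57628 ∷ 19740 ∷ 11548 ∷ 7452 ∷ 21276 ∷
  34588 ∷ 42140 ∷ 19612 ∷ 49820 ∷ 37532 ∷ 10908 ∷ 18076 ∷ 20892 ∷ 12700 ∷ 10652 ∷ 34204 ∷ 53340 ∷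
  26716 ∷ 21596 ∷ 41564 ∷ 35420 ∷ 3676 ∷ 41308 ∷ 9564 ∷ 17244 ∷ 4956 ∷ 24796 ∷ 12508 ∷ 35036 ∷
  6364 ∷ 1500 ∷ 45116 ∷ 28732 ∷ 35900 ∷ 19516 ∷ 25148 ∷ 17980 ∷ 37180 ∷ 35132 ∷ 2876 ∷ 1852 ∷
  49340 ∷ 18620 ∷ 9404 ∷ 5308 ∷ 8892 ∷ 49276 ∷ 10364 ∷ 6268 ∷ 33916 ∷ 4476 ∷ 764 ∷ 508 ∷
  64514 ∷ 56834 ∷ 63746 ∷ 47874 ∷ 59138 ∷ 24322 ∷ 31362 ∷ 54914 ∷ 44674 ∷ 28290 ∷ 31106 ∷ 15746 ∷
  54146 ∷ 51074 ∷ 38786 ∷ 46658 ∷ 44610 ∷ 28226 ∷ 54594 ∷ 30018 ∷ 52546 ∷ 54082 ∷ 29506 ∷ 43842 ∷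
  27458 ∷ 59586 ∷ 29890 ∷ 52418 ∷ 40130 ∷ 58050 ∷ 15042 ∷ 22210 ∷ 45506 ∷ 51650 ∷ 39362 ∷ 42434 ∷
  19906 ∷ 34754 ∷ 48162 ∷ 47650 ∷ 30242 ∷ 55586 ∷ 52514 ∷ 44322 ∷ 29474 ∷ 26402 ∷ 14114 ∷ 61602 ∷
  27810 ∷ 23714 ∷ 51874 ∷ 42658 ∷ 7842 ∷ 57762 ∷ 22946 ∷ 38306 ∷ 11682 ∷ 41890 ∷ 35746 ∷ 7074 ∷
  18338 ∷ 59490 ∷ 58466 ∷ 15458 ∷ 57954 ∷ 39522 ∷ 23138 ∷ 22114 ∷ 45410 ∷ 14690 ∷ 36194 ∷ 19810 ∷
  19298 ∷ 10082 ∷ 53474 ∷ 38114 ∷ 13538 ∷ 49890 ∷ 25314 ∷ 10978 ∷ 3810 ∷ 10722 ∷ 17890 ∷ 5090 ∷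
  55826 ∷ 58898 ∷ 30226 ∷ 15890 ∷ 46354 ∷ 40210 ∷ 15634 ∷ 58130 ∷ 23314 ∷ 42770 ∷ 29842 ∷ 52370 ∷
  40082 ∷ 45714 ∷ 43666 ∷ 27282 ∷ 57746 ∷ 51602 ∷ 39314 ∷ 11666 ∷ 7570 ∷ 21394 ∷ 34706 ∷ 55378 ∷
  30802 ∷ 54354 ∷ 44114 ∷ 14930 ∷ 50770 ∷ 20050 ∷ 43346 ∷ 25938 ∷ 37714 ∷ 13138 ∷ 3922 ∷ 45266 ∷
  22738 ∷ 11474 ∷ 19154 ∷ 34514 ∷ 5842 ∷ 25042 ∷ 20946 ∷ 5586 ∷ 33746 ∷ 3026 ∷ 61490 ∷ 54322 ∷
  27698 ∷ 45618 ∷ 51762 ∷ 7730 ∷ 28978 ∷ 43314 ∷ 26930 ∷ 21810 ∷ 35634 ∷ 6962 ∷ 10034 ∷ 39090 ∷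
  14514 ∷ 50354 ∷ 42162 ∷ 37554 ∷ 12978 ∷ 18098 ∷ 12722 ∷ 17330 ∷ 1970 ∷ 22642 ∷ 25714 ∷ 35954 ∷
  35442 ∷ 9842 ∷ 5746 ∷ 49522 ∷ 37234 ∷ 5490 ∷ 17266 ∷ 9074 ∷ 41202 ∷ 24818 ∷ 3314 ∷ 2546 ∷
  60426 ∷ 46602 ∷ 15882 ∷ 59658 ∷ 23818 ∷ 45834 ∷ 51978 ∷ 22282 ∷ 36618 ∷ 12042 ∷ 47242 ∷ 58506 ∷
  46218 ∷ 23690 ∷ 29322 ∷ 51850 ∷ 39562 ∷ 53642 ∷ 43402 ∷ 25994 ∷ 13706 ∷ 25482 ∷ 7050 ∷ 3978 ∷
  61514 ∷ 27722 ∷ 53834 ∷ 50762 ∷ 36426 ∷ 7754 ∷ 26954 ∷ 22858 ∷ 38218 ∷ 13642 ∷ 41802 ∷ 6986 ∷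
  22730 ∷ 14538 ∷ 41674 ∷ 13002 ∷ 35530 ∷ 18122 ∷ 10698 ∷ 9674 ∷ 5578 ∷ 17354 ∷ 55338 ∷ 29738 ∷
  39978 ∷ 57898 ∷ 27178 ∷ 14890 ∷ 42538 ∷ 20010 ∷ 57642 ∷ 45354 ∷ 50474 ∷ 38186 ∷ 21290 ∷ 3882 ∷
  26794 ∷ 50346 ∷ 36010 ∷ 37546 ∷ 5802 ∷ 12714 ∷ 18858 ∷ 9130 ∷ 28778 ∷ 39018 ∷ 42090 ∷ 19562 ∷
  37482 ∷ 10858 ∷ 20842 ∷ 34154 ∷ 5482 ∷ 2922 ∷ 20714 ∷ 35050 ∷ 9450 ∷ 1770 ∷ 33258 ∷ 1002 ∷
  61466 ∷ 30746 ∷ 44058 ∷ 38426 ∷ 22042 ∷ 19994 ∷ 14618 ∷ 50458 ∷ 25882 ∷ 37658 ∷ 19226 ∷ 11034 ∷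
  53402 ∷ 26778 ∷ 21658 ∷ 25242 ∷ 35482 ∷ 3738 ∷ 41370 ∷ 17818 ∷ 9626 ∷ 5018 ∷ 57434 ∷ 45146 ∷
  39002 ∷ 13402 ∷ 7258 ∷ 25178 ∷ 9818 ∷ 49498 ∷ 35162 ∷ 3418 ∷ 17242 ∷ 1882 ∷ 49370 ∷ 10458 ∷
  34010 ∷ 4826 ∷ 51258 ∷ 43066 ∷ 7226 ∷ 49722 ∷ 21050 ∷ 10810 ∷ 34362 ∷ 6458 ∷ 34106 ∷ 17722 ∷
  20666 ∷ 9402 ∷ 3258 ∷ 8890 ∷ 33210 ∷ 2490 ∷ 12410 ∷ 18554 ∷ 33402 ∷ 8570 ∷ 16634 ∷ 4346 ∷
  63494 ∷ 59910 ∷ 24070 ∷ 61702 ∷ 29958 ∷ 27910 ∷ 40198 ∷ 27398 ∷ 39686 ∷ 42758 ∷ 47238 ∷ 58502 ∷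
  46214 ∷ 53894 ∷ 14982 ∷ 36486 ∷ 43398 ∷ 21894 ∷ 19846 ∷ 25478 ∷ 13190 ∷ 6022 ∷ 3974 ∷ 58438 ∷
  40006 ∷ 15430 ∷ 45638 ∷ 51782 ∷ 38470 ∷ 13894 ∷ 22854 ∷ 42310 ∷ 11590 ∷ 35654 ∷ 18246 ∷ 5958 ∷
  28870 ∷ 39110 ∷ 7366 ∷ 21190 ∷ 19142 ∷ 9926 ∷ 49606 ∷ 25030 ∷ 9158 ∷ 3014 ∷ 54310 ∷ 29222 ∷
  23078 ∷ 50726 ∷ 38438 ∷ 36390 ∷ 11814 ∷ 43302 ∷ 13606 ∷ 7462 ∷ 49958 ∷ 37670 ∷ 19238 ∷ 51366 ∷
  22694 ∷ 25766 ∷ 13478 ∷ 41638 ∷ 10918 ∷ 20902 ∷ 35238 ∷ 10662 ∷ 34214 ∷ 53350 ∷ 45158 ∷ 26726 ∷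
  14438 ∷ 7270 ∷ 3686 ∷ 49510 ∷ 24934 ∷ 33638 ∷ 1894 ∷ 41190 ∷ 34022 ∷ 17638 ∷ 4838 ∷ 4582 ∷
  46102 ∷ 52246 ∷ 27670 ∷ 53782 ∷ 29206 ∷ 43542 ∷ 36374 ∷ 53526 ∷ 22806 ∷ 50454 ∷ 11030 ∷ 5910 ∷
  3862 ∷ 57494 ∷ 28822 ∷ 51350 ∷ 19606 ∷ 6806 ∷ 18070 ∷ 9878 ∷ 12694 ∷ 34198 ∷ 9110 ∷ 43094 ∷
  21590 ∷ 49750 ∷ 25174 ∷ 6742 ∷ 41302 ∷ 12630 ∷ 18774 ∷ 6486 ∷ 17750 ∷ 37078 ∷ 10454 ∷ 9430 ∷
  33494 ∷ 1494 ∷ 57398 ∷ 26678 ∷ 14390 ∷ 42038 ∷ 19510 ∷ 17974 ∷ 37174 ∷ 9526 ∷ 3382 ∷ 33590 ∷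
  37046 ∷ 5302 ∷ 17078 ∷ 2742 ∷ 16822 ∷ 20598 ∷ 34934 ∷ 33910 ∷ 8822 ∷ 4726 ∷ 2294 ∷ 502 ∷
  30734 ∷ 54286 ∷ 23566 ∷ 57870 ∷ 39438 ∷ 26126 ∷ 14606 ∷ 42254 ∷ 36110 ∷ 49934 ∷ 13070 ∷ 18190 ∷
  53390 ∷ 35982 ∷ 11406 ∷ 19086 ∷ 34446 ∷ 9870 ∷ 5774 ∷ 49550 ∷ 37262 ∷ 18830 ∷ 28750 ∷ 51278 ∷
  43086 ∷ 50254 ∷ 25678 ∷ 21070 ∷ 10830 ∷ 6734 ∷ 37198 ∷ 3406 ∷ 9038 ∷ 41166 ∷ 17614 ∷ 3278 ∷
  33230 ∷ 4558 ∷ 45102 ∷ 51246 ∷ 43054 ∷ 21550 ∷ 11310 ∷ 9774 ∷ 24878 ∷ 6446 ∷ 4910 ∷ 1838 ∷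
  24750 ∷ 12462 ∷ 6318 ∷ 33454 ∷ 17070 ∷ 1454 ∷ 17518 ∷ 33390 ∷ 17006 ∷ 8558 ∷ 2414 ∷ 2286 ∷
  38942 ∷ 37918 ∷ 13342 ∷ 11294 ∷ 41502 ∷ 12830 ∷ 18974 ∷ 24862 ∷ 20766 ∷ 35102 ∷ 33566 ∷ 41118 ∷
  6302 ∷ 5278 ∷ 2462 ∷ 926 ∷ 18526 ∷ 33886 ∷ 1630 ∷ 4446 ∷ 16606 ∷ 734 ∷ 5182 ∷ 4670 ∷
  2622 ∷ 16702 ∷ 8510 ∷ 32958 ∷ 8318 ∷ 1150 ∷ 64513 ∷ 62977 ∷ 60673 ∷ 56065 ∷ 30465 ∷ 44801 ∷
  60033 ∷ 47745 ∷ 52865 ∷ 31105 ∷ 40321 ∷ 23937 ∷ 58241 ∷ 45953 ∷ 38785 ∷ 22401 ∷ 46657 ∷ 15937 ∷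
  59713 ∷ 46401 ∷ 40257 ∷ 23873 ∷ 58177 ∷ 52033 ∷ 27457 ∷ 47297 ∷ 54465 ∷ 52417 ∷ 27841 ∷ 29377 ∷
  23233 ∷ 50881 ∷ 26305 ∷ 36545 ∷ 53697 ∷ 43457 ∷ 13761 ∷ 19393 ∷ 31265 ∷ 28193 ∷ 15905 ∷ 55585 ∷
  47393 ∷ 58657 ∷ 15649 ∷ 54049 ∷ 23329 ∷ 42785 ∷ 59553 ∷ 58529 ∷ 46241 ∷ 23713 ∷ 39585 ∷ 22177 ∷
  51617 ∷ 13729 ∷ 36257 ∷ 25505 ∷ 13217 ∷ 4001 ∷ 47201 ∷ 52321 ∷ 27745 ∷ 53857 ∷ 50785 ∷ 26209 ∷
  11873 ∷ 7777 ∷ 29025 ∷ 38241 ∷ 21857 ∷ 41825 ∷ 19297 ∷ 28897 ∷ 42209 ∷ 7393 ∷ 41697 ∷ 37601 ∷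
  10977 ∷ 18913 ∷ 10721 ∷ 34273 ∷ 17377 ∷ 2017 ∷ 31761 ∷ 58897 ∷ 52753 ∷ 24081 ∷ 47377 ∷ 29969 ∷
  45841 ∷ 39697 ∷ 15121 ∷ 55441 ∷ 54417 ∷ 15505 ∷ 29329 ∷ 13969 ∷ 36497 ∷ 20113 ∷ 53649 ∷ 43409 ∷
  42385 ∷ 26001 ∷ 7057 ∷ 34705 ∷ 61521 ∷ 44113 ∷ 40017 ∷ 53841 ∷ 27217 ∷ 42577 ∷ 7761 ∷ 22865 ∷
  50513 ∷ 11601 ∷ 21329 ∷ 35665 ∷ 18257 ∷ 10065 ∷ 57553 ∷ 26833 ∷ 14545 ∷ 35537 ∷ 5841 ∷ 49617 ∷
  37329 ∷ 5585 ∷ 3537 ∷ 9169 ∷ 61489 ∷ 59441 ∷ 39985 ∷ 45617 ∷ 43569 ∷ 38449 ∷ 22065 ∷ 28977 ∷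
  50481 ∷ 11569 ∷ 6961 ∷ 18225 ∷ 10033 ∷ 39089 ∷ 42161 ∷ 19633 ∷ 49841 ∷ 25265 ∷ 10929 ∷ 10673 ∷
  6577 ∷ 17841 ∷ 33713 ∷ 5041 ∷ 51313 ∷ 22641 ∷ 25713 ∷ 13425 ∷ 12913 ∷ 24945 ∷ 12657 ∷ 35185 ∷
  33649 ∷ 2929 ∷ 37105 ∷ 20721 ∷ 3313 ∷ 1777 ∷ 62473 ∷ 61961 ∷ 47625 ∷ 28169 ∷ 40457 ∷ 54537 ∷
  44297 ∷ 23305 ∷ 26377 ∷ 38665 ∷ 55433 ∷ 27785 ∷ 15497 ∷ 23177 ∷ 42633 ∷ 7817 ∷ 29065 ∷ 27017 ∷
  14729 ∷ 50569 ∷ 35721 ∷ 11145 ∷ 18313 ∷ 55369 ∷ 30793 ∷ 29769 ∷ 43593 ∷ 22089 ∷ 36425 ∷ 57673 ∷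
  13641 ∷ 19785 ∷ 37705 ∷ 13129 ∷ 11081 ∷ 3913 ∷ 45257 ∷ 25801 ∷ 11465 ∷ 49865 ∷ 37577 ∷ 41417 ∷
  6601 ∷ 34249 ∷ 5065 ∷ 1993 ∷ 30761 ∷ 52265 ∷ 39977 ∷ 57897 ∷ 51753 ∷ 42537 ∷ 57641 ∷ 45353 ∷
  21801 ∷ 19753 ∷ 11049 ∷ 5929 ∷ 3881 ∷ 43177 ∷ 21673 ∷ 21161 ∷ 12969 ∷ 35497 ∷ 34473 ∷ 9897 ∷
  49577 ∷ 37289 ∷ 9641 ∷ 53353 ∷ 45161 ∷ 50281 ∷ 35945 ∷ 12905 ∷ 19049 ∷ 35177 ∷ 6505 ∷ 9577 ∷
  4969 ∷ 24809 ∷ 6377 ∷ 5353 ∷ 2793 ∷ 16873 ∷ 59417 ∷ 14873 ∷ 22041 ∷ 11801 ∷ 45337 ∷ 51481 ∷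
  26905 ∷ 42265 ∷ 19737 ∷ 7449 ∷ 49945 ∷ 25369 ∷ 34585 ∷ 57497 ∷ 28825 ∷ 38041 ∷ 13465 ∷ 11417 ∷
  49817 ∷ 37529 ∷ 3481 ∷ 17305 ∷ 2969 ∷ 39001 ∷ 14425 ∷ 50265 ∷ 42073 ∷ 41561 ∷ 19033 ∷ 18009 ∷
  5721 ∷ 20825 ∷ 5465 ∷ 20697 ∷ 35033 ∷ 18649 ∷ 8921 ∷ 8665 ∷ 53305 ∷ 22585 ∷ 37945 ∷ 13369 ∷
  35897 ∷ 25145 ∷ 6713 ∷ 3641 ∷ 35129 ∷ 17209 ∷ 41145 ∷ 18617 ∷ 17593 ∷ 8633 ∷ 4537 ∷ 24697 ∷
  10361 ∷ 33401 ∷ 33145 ∷ 1401 ∷ 1273 ∷ 761 ∷ 56325 ∷ 54789 ∷ 44549 ∷ 30981 ∷ 15621 ∷ 29445 ∷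
  43781 ∷ 50949 ∷ 20229 ∷ 7941 ∷ 61573 ∷ 40069 ∷ 27269 ∷ 14981 ∷ 42629 ∷ 38533 ∷ 57733 ∷ 51589 ∷
  19845 ∷ 11653 ∷ 21381 ∷ 10117 ∷ 55365 ∷ 30789 ∷ 29765 ∷ 44101 ∷ 57925 ∷ 39493 ∷ 14917 ∷ 22085 ∷
  45381 ∷ 50501 ∷ 25925 ∷ 37701 ∷ 10053 ∷ 3909 ∷ 42181 ∷ 13509 ∷ 10949 ∷ 6853 ∷ 5829 ∷ 20933 ∷
  12741 ∷ 35269 ∷ 17861 ∷ 33733 ∷ 61477 ∷ 46117 ∷ 23589 ∷ 51749 ∷ 39461 ∷ 13861 ∷ 43301 ∷ 26917 ∷
  36133 ∷ 25381 ∷ 34597 ∷ 5925 ∷ 53413 ∷ 28837 ∷ 14501 ∷ 25765 ∷ 11429 ∷ 49829 ∷ 18085 ∷ 3749 ∷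
  37285 ∷ 6565 ∷ 33701 ∷ 2981 ∷ 57445 ∷ 43109 ∷ 37989 ∷ 21093 ∷ 35429 ∷ 6757 ∷ 37221 ∷ 17765 ∷
  3429 ∷ 9061 ∷ 49381 ∷ 18661 ∷ 5349 ∷ 8677 ∷ 47125 ∷ 58389 ∷ 27669 ∷ 53781 ∷ 29205 ∷ 51733 ∷
  27157 ∷ 53525 ∷ 22805 ∷ 38165 ∷ 13589 ∷ 36117 ∷ 41749 ∷ 3861 ∷ 45205 ∷ 22677 ∷ 25749 ∷ 35989 ∷
  41621 ∷ 19093 ∷ 10901 ∷ 24981 ∷ 5525 ∷ 1941 ∷ 51285 ∷ 37973 ∷ 19541 ∷ 12885 ∷ 34389 ∷ 24917 ∷
  10581 ∷ 4949 ∷ 41173 ∷ 6357 ∷ 17621 ∷ 17109 ∷ 2517 ∷ 981 ∷ 50229 ∷ 21557 ∷ 11317 ∷ 35381 ∷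
  18997 ∷ 9781 ∷ 49461 ∷ 41269 ∷ 18741 ∷ 5429 ∷ 12469 ∷ 33973 ∷ 4789 ∷ 16821 ∷ 41077 ∷ 6261 ∷
  3189 ∷ 17013 ∷ 1653 ∷ 4469 ∷ 33013 ∷ 8437 ∷ 59405 ∷ 46093 ∷ 44045 ∷ 23053 ∷ 13837 ∷ 19981 ∷
  53517 ∷ 39181 ∷ 25869 ∷ 49933 ∷ 13069 ∷ 35597 ∷ 45197 ∷ 51341 ∷ 39053 ∷ 50317 ∷ 21645 ∷ 25229 ∷
  3725 ∷ 41357 ∷ 9613 ∷ 5517 ∷ 5005 ∷ 57421 ∷ 19533 ∷ 7245 ∷ 49741 ∷ 25165 ∷ 34381 ∷ 18765 ∷
  10573 ∷ 6477 ∷ 34125 ∷ 20685 ∷ 35021 ∷ 3277 ∷ 17101 ∷ 8909 ∷ 26669 ∷ 14381 ∷ 25645 ∷ 7213 ∷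
  41517 ∷ 37421 ∷ 17965 ∷ 20781 ∷ 12589 ∷ 34093 ∷ 17197 ∷ 18605 ∷ 33965 ∷ 8877 ∷ 2477 ∷ 20589 ∷
  10349 ∷ 9325 ∷ 1645 ∷ 877 ∷ 33005 ∷ 493 ∷ 28701 ∷ 43037 ∷ 50205 ∷ 21533 ∷ 7197 ∷ 37405 ∷
  9757 ∷ 6429 ∷ 8989 ∷ 2845 ∷ 34973 ∷ 4765 ∷ 1693 ∷ 33181 ∷ 16797 ∷ 36957 ∷ 12381 ∷ 9309 ∷
  2653 ∷ 33117 ∷ 16733 ∷ 1245 ∷ 10301 ∷ 33341 ∷ 4669 ∷ 8509 ∷ 1341 ∷ 4285 ∷ 2237 ∷ 16509 ∷
  63491 ∷ 62467 ∷ 59907 ∷ 40451 ∷ 54531 ∷ 27907 ∷ 15107 ∷ 14083 ∷ 36611 ∷ 20227 ∷ 30851 ∷ 44163 ∷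
  53891 ∷ 26243 ∷ 13955 ∷ 7811 ∷ 45443 ∷ 29059 ∷ 50563 ∷ 42371 ∷ 35715 ∷ 19331 ∷ 11139 ∷ 46147 ∷
  23619 ∷ 45635 ∷ 29251 ∷ 51779 ∷ 23107 ∷ 57667 ∷ 39235 ∷ 14659 ∷ 11587 ∷ 34627 ∷ 18243 ∷ 5955 ∷
  57539 ∷ 53443 ∷ 39107 ∷ 25795 ∷ 9923 ∷ 3779 ∷ 6595 ∷ 3523 ∷ 9155 ∷ 5059 ∷ 55331 ∷ 44067 ∷
  29219 ∷ 43555 ∷ 50723 ∷ 38435 ∷ 20003 ∷ 53539 ∷ 25891 ∷ 7459 ∷ 49955 ∷ 37667 ∷ 11043 ∷ 45219 ∷
  22691 ∷ 21667 ∷ 36003 ∷ 11427 ∷ 41635 ∷ 19107 ∷ 24995 ∷ 5539 ∷ 1955 ∷ 26723 ∷ 14435 ∷ 50275 ∷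
  21603 ∷ 35427 ∷ 34403 ∷ 41315 ∷ 6499 ∷ 9571 ∷ 4963 ∷ 12515 ∷ 35043 ∷ 4835 ∷ 33251 ∷ 16867 ∷
  58387 ∷ 23571 ∷ 57875 ∷ 39443 ∷ 11795 ∷ 45331 ∷ 51475 ∷ 26899 ∷ 21779 ∷ 36115 ∷ 49939 ∷ 25363 ∷
  5907 ∷ 51347 ∷ 43155 ∷ 38035 ∷ 13459 ∷ 21139 ∷ 6803 ∷ 9875 ∷ 18835 ∷ 17811 ∷ 9107 ∷ 28755 ∷
  43091 ∷ 42067 ∷ 19539 ∷ 7251 ∷ 37459 ∷ 10835 ∷ 20819 ∷ 34131 ∷ 2899 ∷ 12499 ∷ 17619 ∷ 33491 ∷
  17107 ∷ 8659 ∷ 26675 ∷ 14387 ∷ 37939 ∷ 13363 ∷ 21043 ∷ 34355 ∷ 3635 ∷ 41267 ∷ 18739 ∷ 3379 ∷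
  49331 ∷ 24755 ∷ 2739 ∷ 33203 ∷ 4531 ∷ 49267 ∷ 36979 ∷ 17011 ∷ 8819 ∷ 1395 ∷ 2291 ∷ 1267 ∷
  47115 ∷ 52235 ∷ 15371 ∷ 53771 ∷ 27147 ∷ 50699 ∷ 28939 ∷ 39179 ∷ 42251 ∷ 7435 ∷ 21259 ∷ 9995 ∷
  57483 ∷ 38027 ∷ 19595 ∷ 41611 ∷ 12939 ∷ 18059 ∷ 20875 ∷ 35211 ∷ 3467 ∷ 33675 ∷ 51275 ∷ 43083 ∷
  37963 ∷ 21579 ∷ 11339 ∷ 25163 ∷ 6731 ∷ 9803 ∷ 49483 ∷ 24907 ∷ 33611 ∷ 18635 ∷ 33995 ∷ 5323 ∷
  2763 ∷ 16843 ∷ 28715 ∷ 25643 ∷ 13355 ∷ 6699 ∷ 5675 ∷ 35115 ∷ 18731 ∷ 10539 ∷ 33579 ∷ 9003 ∷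
  49323 ∷ 37035 ∷ 10411 ∷ 6315 ∷ 17067 ∷ 1451 ∷ 41067 ∷ 3179 ∷ 17003 ∷ 1643 ∷ 16747 ∷ 8427 ∷
  53275 ∷ 22555 ∷ 25627 ∷ 35867 ∷ 41499 ∷ 12827 ∷ 35355 ∷ 18971 ∷ 37147 ∷ 12571 ∷ 1819 ∷ 10395 ∷
  6299 ∷ 33947 ∷ 1691 ∷ 4507 ∷ 17499 ∷ 4699 ∷ 8539 ∷ 2395 ∷ 32987 ∷ 475 ∷ 41019 ∷ 17467 ∷
  9275 ∷ 4411 ∷ 827 ∷ 699 ∷ 4219 ∷ 2171 ∷ 29703 ∷ 52231 ∷ 15367 ∷ 45575 ∷ 23047 ∷ 26119 ∷
  11783 ∷ 57607 ∷ 51463 ∷ 38151 ∷ 41735 ∷ 6919 ∷ 43143 ∷ 26759 ∷ 50311 ∷ 21639 ∷ 7303 ∷ 49799 ∷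
  37511 ∷ 37255 ∷ 6535 ∷ 9607 ∷ 17287 ∷ 53319 ∷ 26695 ∷ 35911 ∷ 41543 ∷ 17991 ∷ 3655 ∷ 20807 ∷
  12615 ∷ 35143 ∷ 17223 ∷ 18631 ∷ 10439 ∷ 33991 ∷ 33479 ∷ 1479 ∷ 57383 ∷ 38951 ∷ 42023 ∷ 19495 ∷
  25127 ∷ 12839 ∷ 20775 ∷ 12583 ∷ 34087 ∷ 17703 ∷ 2855 ∷ 34983 ∷ 4775 ∷ 1703 ∷ 8615 ∷ 18535 ∷
  9319 ∷ 5223 ∷ 8807 ∷ 2407 ∷ 16615 ∷ 743 ∷ 45079 ∷ 38935 ∷ 14359 ∷ 34327 ∷ 17943 ∷ 5655 ∷
  10519 ∷ 9495 ∷ 17175 ∷ 4887 ∷ 20631 ∷ 3223 ∷ 33431 ∷ 33175 ∷ 2455 ∷ 49239 ∷ 24663 ∷ 9303 ∷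
  5207 ∷ 2647 ∷ 33111 ∷ 4311 ∷ 20535 ∷ 34871 ∷ 6199 ∷ 8759 ∷ 823 ∷ 8375 ∷ 1207 ∷ 375 ∷
  22543 ∷ 41999 ∷ 21007 ∷ 35343 ∷ 10767 ∷ 34319 ∷ 5647 ∷ 41231 ∷ 18703 ∷ 10511 ∷ 17679 ∷ 5391 ∷
  24719 ∷ 12431 ∷ 2703 ∷ 911 ∷ 36943 ∷ 12367 ∷ 1359 ∷ 847 ∷ 8399 ∷ 4303 ∷ 49199 ∷ 36911 ∷
  3119 ∷ 2607 ∷ 1199 ∷ 431 ∷ 32879 ∷ 4207 ∷ 49183 ∷ 24607 ∷ 3103 ∷ 1311 ∷ 16543 ∷ 8351 ∷
  2143 ∷ 607 ∷ 32831 ∷ 16447 ∷ []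

blocks : List (Subset 16)
blocks = map (fromBits 16) codes

theorem8 : ∃ (λ (B : List (Subset 16)) → IsSimpleDesign 5 16 7 10 B)
theorem8 = blocks , record
  { design = record
    { blockSize = toWitness {a? = all? (λ b → ∣ b ∣ ℕ.≟ 7) blocks} _
    ; balanced  = balancedᵇ-sound 5 10 blocks _
    }
  ; simple = strictlyAscending⇒Unique (lexStrictPartialOrder 16)
               (toWitness {a? = linked? (Lex.<-decidable Bool._≟_ Bool._<?_) blocks} _)
  }
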